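{- Let $\phi$ and the graph $G$ with integer $k$ be as constructed in the context, with $n$ sufficiently large. Then every minimal feedback vertex set $S$ of $G$ with $|S|\ge k$ satisfies: (i) $S$ contains no vertex to which a force gadget is attached and no gadget twin of such a vertex; (ii) $|M_i\setminus S|\le 1$ for every gadget $G_p^q$ and every $i\in[2L]$; (iii) $|S\cap V(G_p^q)| = 4AL+AR+2LR$ for every $p\in[3]$, $q\in[\log n]$.
   Context: A feedback vertex set of $G$ is a vertex set whose removal leaves a forest; it is minimal if no proper subset is a feedback vertex set. Construction: Let $\phi$ be a 3-CNF formula with $m$ clauses whose variables are partitioned into $V_1,V_2,V_3$ with $|V_p|=n$, such that no clause contains more than one variable from any $V_p$. Assume $n$ is a power of $4$; logarithms are base $2$. Partition each $V_p$ ($p\in[3]$) into $\log n$ sets $V_p^q$ ($q\in[\log n]$), each of size at most $\lceil n/\log n\rceil$. Let $L=\lceil n/\log^2 n\rceil$ and partition each $V_p^q$ into $2L$ sets $\mathcal V^{p,q}_\alpha$ ($\alpha\in[2L]$) of sizes as equal as possible (each then has at most $(\log n)/2$ variables). Let $R=\sqrt n$, $A=n^2+m$, $k=(4AL+AR+2LR)\cdot 3\log n+m$. For each $p,q,\alpha$ fix a map $\beta\mapsto\sigma^{p,q}_{\alpha,\beta}$ from $[R]$ onto the set of truth assignments of $\mathcal V^{p,q}_\alpha$. Attaching a force gadget to a vertex $u$ means adding $A+1$ new vertices $\bar u$ (the gadget twin) and $u_1,\dots,u_A$ (gadget leaves) with edges $u\bar u$, $uu_i$, $\bar u u_i$ for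 $i\in[A]$. For each $p\in[3],q\in[\log n]$ the choice gadget $G_p^q$ has vertices $\ell_i,\ell'_i,\kappa_i,\lambda_i$ ($i\in[2L]$), $r_j$ ($j\in[R]$), $m^i_j$ ($i\in[2L],j\in[R]$), with $M_i=\{m^i_j: j\in[R]\}$; its edges are $\kappa_i\lambda_i$ and, for all $i,j$, $\kappa_i m^i_j$, $\lambda_i m^i_j$, $\ell_i m^i_j$, $\ell'_i m^i_j$, $r_j m^i_j$; a force gadget is attached to every $\ell_i$, $\ell'_i$, $r_j$, and these gadget vertices are counted as vertices of $G_p^q$. The graph $G$ is the disjoint union of all $3\log n$ gadgets $G_p^q$ plus one vertex $c$ per clause $C$ of $\phi$; $c$ is adjacent to $\ell_\alpha$ of $G_p^q$ whenever $\mathcal V^{p,q}_\alpha$ contains a variable of $C$, and for each such $\alpha$, $c$ is adjacent to $r_\beta$ of $G_p^q$ for every $\beta\in[R]$ such that $\sigma^{p,q}_{\alpha,\beta}$ satisfies $C$. -}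

module Defs where

open import Data.Nat using (ℕ; zero; suc; _+_; _*_; _^_; _≤_; _/_)
open import Data.Fin using (Fin; zero; suc)
open import Data.Fin.Properties using (_≟_)
open import Data.Bool using (Bool; true; false; _∧_; if_then_else_)
open import Data.Product using (_×_; _,_; proj₁; proj₂; ∃)
open import Data.Sum using (_⊎_)
open import Data.Empty using (⊥)
open import Data.List using (List; []; _∷_; length)
open import Data.List.Relation.Unary.Any using (Any)
open import Data.List.Relation.Unary.All using (All)
open import Data.List.Relation.Unary.AllPairs using (AllPairs)
open import Data.List.Relation.Unary.Linked using (Linked)
open import Data.List.Relation.Unary.Unique.Propositional using (Unique)
open import Data.List.Membership.Propositional using (_∈_; _∉_)
open import Relation.Binary.PropositionalEquality using (_≡_; _≢_)
open import Relation.Nullary using (¬_)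
open import Relation.Nullary.Decidable using (⌊_⌋)

-- Arithmetic parameters.  n = 4 ^ t (n a power of 4), log n = 2 t.

-- ceiling division ⌈ a / b ⌉ (only used with b ≥ 1; value 0 for b = 0)
ceilDiv : ℕ → ℕ → ℕ
ceilDiv a zero    = 0
ceilDiv a (suc b) = (a + b) / suc b

nOf : ℕ → ℕ
nOf t = 4 ^ t

lg : ℕ → ℕ
lg t = 2 * t

Rof : ℕ → ℕ
Rof t = 2 ^ t

Lof : ℕ → ℕ
Lof t = ceilDiv (nOf t) (lg t * lg t)

Aof : ℕ → ℕ → ℕ
Aof t m = nOf t * nOf t + m

gadgetBudget : ℕ → ℕ → ℕ
gadgetBudget t m = 4 * Aof t m * Lof t + Aof t m * Rof t + 2 * Lof t * Rof t

kOf : ℕ → ℕ → ℕ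
kOf t m = gadgetBudget t m * (3 * lg t) + m

-- Formulas.  Variables are pairs (p , x) with p ∈ Fin 3 (the part V_p)
-- and x ∈ Fin n.  A literal (p , x , s) is satisfied by an assignment
-- a iff a x ≡ s (s = true: positive literal).

Literal : ℕ → Set
Literal n = Fin 3 × Fin n × Bool

Clause : ℕ → Set
Clause n = List (Literal n)

AtMostOnePerPart : ∀ {n m} → (Fin m → Clause n) → Set
AtMostOnePerPart φ = ∀ c → AllPairs (λ l l' → proj₁ l ≢ proj₁ l') (φ c)

cnt : ∀ {n} → (Fin n → Bool) → ℕ
cnt {zero}  f = 0
cnt {suc n} f = (if f zero then 1 else 0) + cnt (λ x → f (suc x))

-- blk p x = (q , α) means variable x of V_p lies in V_p^q and in 𝒱^{p,q}_α
Blocks : ℕ → Set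
Blocks t = Fin 3 → Fin (nOf t) → Fin (lg t) × Fin (2 * Lof t)

sizeV : ∀ t → Blocks t → Fin 3 → Fin (lg t) → ℕ
sizeV t blk p q = cnt (λ x → ⌊ proj₁ (blk p x) ≟ q ⌋)

sizeVα : ∀ t → Blocks t → Fin 3 → Fin (lg t) → Fin (2 * Lof t) → ℕ
sizeVα t blk p q α = cnt (λ x → ⌊ proj₁ (blk p x) ≟ q ⌋ ∧ ⌊ proj₂ (blk p x) ≟ α ⌋)

BlocksOK : ∀ t → Blocks t → Set
BlocksOK t blk =
  (∀ p q → sizeV t blk p q ≤ ceilDiv (nOf t) (lg t)) ×
  (∀ p q α α' → sizeVα t blk p q α ≤ suc (sizeVα t blk p q α'))

-- σ p q α β is (a total extension of) the truth assignment σ^{p,q}_{α,β}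
-- of 𝒱^{p,q}_α; only its values on 𝒱^{p,q}_α matter.
Assignments : ℕ → Set
Assignments t = Fin 3 → Fin (lg t) → Fin (2 * Lof t) → Fin (Rof t) → Fin (nOf t) → Bool

Onto : ∀ t → Blocks t → Assignments t → Set
Onto t blk σ = ∀ p q α (τ : Fin (nOf t) → Bool) →
  ∃ λ β → ∀ x → blk p x ≡ (q , α) → σ p q α β x ≡ τ x

data Forced (L2 R : ℕ) : Set where   -- vertices carrying a force gadget
  fℓ  : Fin L2 → Forced L2 R
  fℓ' : Fin L2 → Forced L2 R
  fr  : Fin R → Forced L2 R

data GV (L2 R A : ℕ) : Set where
  base : Forced L2 R → GV L2 R A
  twin : Forced L2 R → GV L2 R A
  leaf : Forced L2 R → Fin A → GV L2 R A
  κ    : Fin L2 → GV L2 R A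
  λv   : Fin L2 → GV L2 R A
  mv   : Fin L2 → Fin R → GV L2 R A

data Vx (Q L2 R A m : ℕ) : Set where
  gad : Fin 3 → Fin Q → GV L2 R A → Vx Q L2 R A m
  cl  : Fin m → Vx Q L2 R A m

-- edges inside a choice gadget (one orientation)
data GE {L2 R A : ℕ} : GV L2 R A → GV L2 R A → Set where
  e-κλ : ∀ i → GE (κ i) (λv i)
  e-mκ : ∀ i j → GE (mv i j) (κ i)
  e-mλ : ∀ i j → GE (mv i j) (λv i)
  e-mℓ : ∀ i j → GE (mv i j) (base (fℓ i))
  e-mℓ' : ∀ i j → GE (mv i j) (base (fℓ' i))
  e-mr : ∀ i j → GE (mv i j) (base (fr j))
  e-bt : ∀ u → GE (base u) (twin u)
  e-bl : ∀ u a → GE (base u) (leaf u a)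
  e-tl : ∀ u a → GE (twin u) (leaf u a)

module _ {V : Set} (Adj : V → V → Set) where

  lastOr : V → List V → V
  lastOr v []       = v
  lastOr v (w ∷ ws) = lastOr w ws

  Closes : List V → Set
  Closes []       = ⊥
  Closes (v ∷ vs) = Adj (lastOr v vs) v

  IsCycle : List V → Set
  IsCycle cs = (3 ≤ length cs) × Unique cs × Linked Adj cs × Closes cs

  ForestOn : (V → Set) → Set
  ForestOn keep = ∀ cs → IsCycle cs → All keep cs → ⊥

  -- S (a list of vertices, read as a set) is a feedback vertex set
  FVS : List V → Set
  FVS S = ForestOn (λ v → v ∉ S)

  _⊂_ : List V → List V → Set
  T ⊂ S = (∀ {v} → v ∈ T → v ∈ S) × ∃ λ v → v ∈ S × v ∉ T

  MinimalFVS : List V → Set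
  MinimalFVS S = FVS S × (∀ T → T ⊂ S → ¬ FVS T)

module Construction (t m : ℕ) (φ : Fin m → Clause (nOf t))
                    (blk : Blocks t) (σ : Assignments t) where

  L2 = 2 * Lof t
  R  = Rof t
  A  = Aof t m

  V : Set
  V = Vx (lg t) L2 R A m

  ContainsVar : Fin m → Fin 3 → Fin (lg t) → Fin L2 → Set
  ContainsVar c p q α =
    Any (λ l → proj₁ l ≡ p × blk (proj₁ l) (proj₁ (proj₂ l)) ≡ (q , α)) (φ c)

  Satisfies : Fin m → Fin 3 → Fin (lg t) → Fin L2 → Fin R → Set
  Satisfies c p q α β =
    Any (λ l → proj₁ l ≡ p × blk (proj₁ l) (proj₁ (proj₂ l)) ≡ (q , α)
               × σ p q α β (proj₁ (proj₂ l)) ≡ proj₂ (proj₂ l)) (φ c)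

  data E : V → V → Set where
    inG  : ∀ p q {u v} → GE u v → E (gad p q u) (gad p q v)
    clℓ  : ∀ c p q α → ContainsVar c p q α → E (cl c) (gad p q (base (fℓ α)))
    clr  : ∀ c p q α β → ContainsVar c p q α → Satisfies c p q α β →
           E (cl c) (gad p q (base (fr β)))

  Adj : V → V → Set
  Adj u v = E u v ⊎ E v u

  inGadget : Fin 3 → Fin (lg t) → V → Bool
  inGadget p q (gad p' q' _) = ⌊ p ≟ p' ⌋ ∧ ⌊ q ≟ q' ⌋
  inGadget p q (cl _)        = false

  countL : (V → Bool) → List V → ℕ
  countL f []       = 0
  countL f (v ∷ vs) = (if f v then 1 else 0) + countL f vs

  Conclusion : List V → Set
  Conclusion S =
    (∀ p q u → gad p q (base u) ∉ S × gad p q (twin u) ∉ S) ×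
    (∀ p q i j j' → gad p q (mv i j) ∉ S → gad p q (mv i j') ∉ S → j ≡ j') ×
    (∀ p q → countL (inGadget p q) S ≡ gadgetBudget t m)

-- Two facts about a minimal feedback vertex set S drive the count: every vertex of S has two
-- distinct neighbours outside S (otherwise S minus that vertex is still a feedback vertex set),
-- and S must break every 4-cycle ℓ_i m ℓ'_i m' with m, m' ∈ M_i.  The first shows that S meets
-- a force gadget at u in at most A vertices, and in at most 2 if it contains u or ū (then it
-- cannot contain a leaf).  With ℓ_i, ℓ'_i ∉ S the second leaves at most one vertex of M_i outside
-- S, and then the first keeps at most one of κ_i, λ_i in S, so {κ_i, λ_i} ∪ M_i costs at most R.
-- Hence |S ∩ V(G_p^q)| ≤ 2L(2A + R) + RA = 4AL + AR + 2LR, strictly if S contains a forced vertex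
-- or a twin (as A ≥ 5).  Clause vertices contribute at most m, so |S| ≥ k forces equality in every
-- gadget, which gives (i) and (iii), and (ii) follows from (i) and the 4-cycles.

module Submission where

open import Data.Bool using (Bool; true; _∧_; if_then_else_)
open import Data.Empty using (⊥; ⊥-elim)
open import Data.Fin using (Fin; zero; suc)
import Data.Fin.Properties as Fin
open import Data.List using (List; []; _∷_; _++_; [_]; length; filter)
open import Data.List.Membership.Propositional using (_∈_; _∉_)
open import Data.List.Membership.Propositional.Properties
  using (∈-∃++; ∈-filter⁺; ∈-filter⁻)
open import Data.List.Properties using (length-++; ++-assoc; ++-identityʳ)
open import Data.List.Relation.Unary.All as All using (All; []; _∷_)
import Data.List.Relation.Unary.All.Properties as All
open import Data.List.Relation.Unary.Any using (here; there)
open import Data.List.Relation.Unary.AllPairs using ([]; _∷_)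
open import Data.List.Relation.Unary.Linked using (Linked; [-]; _∷_)
open import Data.List.Relation.Unary.Unique.Propositional using (Unique)
import Data.List.Relation.Unary.Unique.Propositional.Properties as Unique
open import Data.Nat using (ℕ; zero; suc; _+_; _*_; _≤_; _<_; z≤n; s≤s)
open import Data.Nat.Properties
open import Data.Nat.Tactic.RingSolver using (solve-∀)
open import Algebra.Properties.CommutativeSemigroup +-commutativeSemigroup
  using () renaming (interchange to +-interchange)
open import Algebra.Properties.CommutativeMonoid.Sum +-0-commutativeMonoid
  using (sum; sum-syntax; ∑-distrib-+; sum-cong-≗)
open import Data.Product using (_×_; _,_; proj₁; proj₂; ∃; ∃₂)
import Data.Product.Properties as Product
open import Data.Sum using (_⊎_; inj₁; inj₂; swap)
import Data.Sum.Properties as Sum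
open import Function using (_∘_)
open import Function.Bundles using (mk↣)
open import Function.Definitions using (Injective)
open import Relation.Binary.Definitions using (DecidableEquality)
open import Relation.Binary.PropositionalEquality
  using (_≡_; _≢_; refl; sym; trans; cong; cong₂; subst; ≡-≟-identity; module ≡-Reasoning)
open import Relation.Nullary using (¬_; yes; no)
open import Relation.Nullary.Decidable using (⌊_⌋; ¬?; via-injection; decidable-stable)
open import Defs

∑-≤-* : ∀ {n c} {f : Fin n → ℕ} → (∀ k → f k ≤ c) → sum f ≤ n * c
∑-≤-* {zero}  f≤c = z≤n
∑-≤-* {suc n} f≤c = +-mono-≤ (f≤c zero) (∑-≤-* (f≤c ∘ suc))

∑-<-* : ∀ {n c} {f : Fin n → ℕ} → (∀ k → f k ≤ c) → ∀ k → f k < c → sum f < n * c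
∑-<-* {suc n} f≤c zero    fk<c = +-mono-<-≤ fk<c (∑-≤-* (f≤c ∘ suc))
∑-<-* {suc n} f≤c (suc k) fk<c = +-mono-≤-< (f≤c zero) (∑-<-* (f≤c ∘ suc) k fk<c)

≤-∑ : ∀ {n} (f : Fin n → ℕ) k → f k ≤ sum f
≤-∑ f zero    = m≤m+n _ _
≤-∑ f (suc k) = ≤-trans (≤-∑ (f ∘ suc) k) (m≤n+m _ _)

x≤x+y+z : ∀ x y z → x ≤ x + y + z
x≤x+y+z x y z = ≤-trans (m≤m+n x y) (m≤m+n _ z)

y≤x+y+z : ∀ x y z → y ≤ x + y + z
y≤x+y+z x y z = ≤-trans (m≤n+m y x) (m≤m+n _ z)

z≤x+y+z : ∀ x y z → z ≤ x + y + z
z≤x+y+z x y z = m≤n+m z (x + y)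

ind : Bool → ℕ
ind b = if b then 1 else 0

⌊≟⌋-refl : ∀ {A : Set} (_≟_ : DecidableEquality A) x → ⌊ x ≟ x ⌋ ≡ true
⌊≟⌋-refl _≟_ x = cong ⌊_⌋ (≡-≟-identity _≟_ refl)

module Multiplicity {V : Set} (_≟_ : DecidableEquality V) where

  multiplicity : List V → V → ℕ
  multiplicity []      w = 0
  multiplicity (x ∷ S) w = ind ⌊ x ≟ w ⌋ + multiplicity S w

  multiplicity-∉ : ∀ {S w} → w ∉ S → multiplicity S w ≡ 0
  multiplicity-∉ {[]}        w∉ = refl
  multiplicity-∉ {x ∷ S} {w} w∉ with x ≟ w
  ... | yes refl = ⊥-elim (w∉ (here refl))
  ... | no _     = multiplicity-∉ (w∉ ∘ there)

  multiplicity-≤1 : ∀ {S} → Unique S → ∀ w → multiplicity S w ≤ 1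
  multiplicity-≤1 {[]}    _            w = z≤n
  multiplicity-≤1 {x ∷ S} (x∉ ∷ uniq) w with x ≟ w
  ... | yes refl = ≤-reflexive (cong suc (multiplicity-∉ (All.All¬⇒¬Any x∉)))
  ... | no _     = multiplicity-≤1 uniq w

-- Cycles and minimal feedback vertex sets

module Cycles {V : Set} (Adj : V → V → Set) where

  lastOr-∈ : ∀ x xs → lastOr Adj x xs ∈ x ∷ xs
  lastOr-∈ x []       = here refl
  lastOr-∈ x (y ∷ ys) = there (lastOr-∈ y ys)

  lastOr-∷ʳ : ∀ x y ys → lastOr Adj x (ys ++ [ y ]) ≡ y
  lastOr-∷ʳ x y []       = refl
  lastOr-∷ʳ x y (z ∷ zs) = lastOr-∷ʳ z y zs

  Linked-∷ʳ : ∀ {y} x xs → Linked Adj (x ∷ xs) → Adj (lastOr Adj x xs) y →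
              Linked Adj (x ∷ xs ++ [ y ])
  Linked-∷ʳ x []       [-]       r = r ∷ [-]
  Linked-∷ʳ x (z ∷ zs) (r ∷ rs) r′ = r ∷ Linked-∷ʳ z zs rs r′

  IsCycle-rotate : ∀ x xs → IsCycle Adj (x ∷ xs) → IsCycle Adj (xs ++ [ x ])
  IsCycle-rotate x [] (s≤s () , _)
  IsCycle-rotate x (y ∷ ys) (3≤len , x∉ ∷ uniq , r ∷ rs , closes) =
    3≤len′ , uniq′ , Linked-∷ʳ y ys rs closes , subst (λ v → Adj v y) (sym (lastOr-∷ʳ y x ys)) r
    where
    3≤len′ : 3 ≤ length (y ∷ ys ++ [ x ])
    3≤len′ rewrite length-++ ys {[ x ]} | +-comm (length ys) 1 = 3≤len
    uniq′ : Unique (y ∷ ys ++ [ x ])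
    uniq′ = Unique.++⁺ uniq ([] ∷ []) λ where (v∈ , here refl) → All.All¬⇒¬Any x∉ v∈

  IsCycle-rotateTo : ∀ w pre post → IsCycle Adj (pre ++ w ∷ post) → IsCycle Adj (w ∷ post ++ pre)
  IsCycle-rotateTo w []        post cyc rewrite ++-identityʳ post = cyc
  IsCycle-rotateTo w (x ∷ pre) post cyc =
    subst (λ cs → IsCycle Adj (w ∷ cs)) (++-assoc post [ x ] pre)
      (IsCycle-rotateTo w pre (post ++ [ x ])
        (subst (IsCycle Adj) (++-assoc pre (w ∷ post) [ x ]) (IsCycle-rotate x (pre ++ w ∷ post) cyc)))

  IsCycle-neighbours : ∀ w cs → IsCycle Adj (w ∷ cs) →
                       ∃₂ λ a b → a ≢ b × a ∈ cs × b ∈ cs × Adj w a × Adj b w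
  IsCycle-neighbours w []           (s≤s () , _)
  IsCycle-neighbours w (a ∷ [])     (s≤s (s≤s ()) , _)
  IsCycle-neighbours w (a ∷ c ∷ cs) (_ , _ ∷ a∉ ∷ _ , r ∷ _ , closes) =
    a , lastOr Adj c cs , a≢b , here refl , there (lastOr-∈ c cs) , r , closes
    where
    a≢b : a ≢ lastOr Adj c cs
    a≢b a≡b = All.All¬⇒¬Any a∉ (subst (_∈ c ∷ cs) (sym a≡b) (lastOr-∈ c cs))

module MinimalFVS {V : Set} (_≟_ : DecidableEquality V) (Adj : V → V → Set)
                  (Adj-sym : ∀ {a b} → Adj a b → Adj b a) (Adj-irrefl : ∀ {a} → ¬ Adj a a) where
  open Cycles Adj
  open import Data.List.Membership.DecPropositional _≟_ using (_∈?_)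

  AtMostOneOutsideNeighbour : List V → V → V → Set
  AtMostOneOutsideNeighbour S w z = ∀ a → Adj a w → a ∉ S → a ≡ z

  _∖_ : List V → V → List V
  S ∖ w = filter (λ v → ¬? (v ≟ w)) S

  ∉-∖ : ∀ {S v w} → v ∉ S ∖ w → v ≢ w → v ∉ S
  ∉-∖ {w = w} v∉ v≢w v∈ = v∉ (∈-filter⁺ (λ v → ¬? (v ≟ w)) v∈ v≢w)

  ∖-⊂ : ∀ {S w} → w ∈ S → _⊂_ Adj (S ∖ w) S
  ∖-⊂ {S} {w} w∈S =
    (λ v∈ → proj₁ (∈-filter⁻ (λ v → ¬? (v ≟ w)) {xs = S} v∈)) ,
    w , w∈S , λ w∈ → proj₂ (∈-filter⁻ (λ v → ¬? (v ≟ w)) {xs = S} w∈) refl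

  -- A cycle avoiding S ∖ w must pass through w, and the two cycle neighbours of w lie outside S.
  FVS-∖ : ∀ {S w z} → FVS Adj S → AtMostOneOutsideNeighbour S w z → FVS Adj (S ∖ w)
  FVS-∖ {S} {w} fvs oneOutside cs cyc avoid with w ∈? cs
  ... | no w∉cs =
    fvs cs cyc (All.tabulate λ v∈cs → ∉-∖ (All.lookup avoid v∈cs) λ where refl → w∉cs v∈cs)
  ... | yes w∈cs with ∈-∃++ w∈cs
  ... | pre , post , refl with IsCycle-neighbours w (post ++ pre) (IsCycle-rotateTo w pre post cyc)
  ... | a , b , a≢b , a∈ , b∈ , w~a , b~w =
    a≢b (trans (oneOutside a (Adj-sym w~a) (outside a∈ w~a)) (sym (oneOutside b b~w (outside b∈ (Adj-sym b~w)))))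
    where
    avoid′ : All (_∉ S ∖ w) (post ++ pre)
    avoid′ with All.++⁻ pre avoid
    ... | avoidPre , _ ∷ avoidPost = All.++⁺ avoidPost avoidPre
    outside : ∀ {v} → v ∈ post ++ pre → Adj w v → v ∉ S
    outside v∈ w~v = ∉-∖ (All.lookup avoid′ v∈) λ where refl → Adj-irrefl w~v

  minimalFVS⇒¬AtMostOneOutsideNeighbour : ∀ {S w z} → MinimalFVS Adj S → w ∈ S →
                                          ¬ AtMostOneOutsideNeighbour S w z
  minimalFVS⇒¬AtMostOneOutsideNeighbour (fvs , minimal) w∈S oneOutside =
    minimal _ (∖-⊂ w∈S) (FVS-∖ fvs oneOutside)

forcedCode : ∀ {L2 R} → Forced L2 R → Fin L2 ⊎ Fin L2 ⊎ Fin R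
forcedCode (fℓ i)  = inj₁ i
forcedCode (fℓ' i) = inj₂ (inj₁ i)
forcedCode (fr j)  = inj₂ (inj₂ j)

forcedCode-injective : ∀ {L2 R} → Injective _≡_ _≡_ (forcedCode {L2} {R})
forcedCode-injective {x = fℓ _}  {fℓ _}  refl = refl
forcedCode-injective {x = fℓ' _} {fℓ' _} refl = refl
forcedCode-injective {x = fr _}  {fr _}  refl = refl

_≟ᶠ_ : ∀ {L2 R} → DecidableEquality (Forced L2 R)
_≟ᶠ_ = via-injection (mk↣ forcedCode-injective) (Sum.≡-dec Fin._≟_ (Sum.≡-dec Fin._≟_ Fin._≟_))

gadgetCode : ∀ {L2 R A} → GV L2 R A →
             Forced L2 R ⊎ Forced L2 R ⊎ (Forced L2 R × Fin A) ⊎ Fin L2 ⊎ Fin L2 ⊎ (Fin L2 × Fin R)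
gadgetCode (base u)   = inj₁ u
gadgetCode (twin u)   = inj₂ (inj₁ u)
gadgetCode (leaf u a) = inj₂ (inj₂ (inj₁ (u , a)))
gadgetCode (κ i)      = inj₂ (inj₂ (inj₂ (inj₁ i)))
gadgetCode (λv i)     = inj₂ (inj₂ (inj₂ (inj₂ (inj₁ i))))
gadgetCode (mv i j)   = inj₂ (inj₂ (inj₂ (inj₂ (inj₂ (i , j)))))

gadgetCode-injective : ∀ {L2 R A} → Injective _≡_ _≡_ (gadgetCode {L2} {R} {A})
gadgetCode-injective {x = base _}   {base _}   refl = refl
gadgetCode-injective {x = twin _}   {twin _}   refl = refl
gadgetCode-injective {x = leaf _ _} {leaf _ _} refl = refl
gadgetCode-injective {x = κ _}      {κ _}      refl = refl
gadgetCode-injective {x = λv _}     {λv _}     refl = refl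
gadgetCode-injective {x = mv _ _}   {mv _ _}   refl = refl

_≟ᵍ_ : ∀ {L2 R A} → DecidableEquality (GV L2 R A)
_≟ᵍ_ = via-injection (mk↣ gadgetCode-injective)
  (Sum.≡-dec _≟ᶠ_ (Sum.≡-dec _≟ᶠ_ (Sum.≡-dec (Product.≡-dec _≟ᶠ_ Fin._≟_)
    (Sum.≡-dec Fin._≟_ (Sum.≡-dec Fin._≟_ (Product.≡-dec Fin._≟_ Fin._≟_))))))

vertexCode : ∀ {Q L2 R A m} → Vx Q L2 R A m → (Fin 3 × Fin Q × GV L2 R A) ⊎ Fin m
vertexCode (gad p q y) = inj₁ (p , q , y)
vertexCode (cl c)      = inj₂ c

vertexCode-injective : ∀ {Q L2 R A m} → Injective _≡_ _≡_ (vertexCode {Q} {L2} {R} {A} {m})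
vertexCode-injective {x = gad _ _ _} {gad _ _ _} refl = refl
vertexCode-injective {x = cl _}      {cl _}      refl = refl

_≟ᵛ_ : ∀ {Q L2 R A m} → DecidableEquality (Vx Q L2 R A m)
_≟ᵛ_ = via-injection (mk↣ vertexCode-injective)
  (Sum.≡-dec (Product.≡-dec Fin._≟_ (Product.≡-dec Fin._≟_ _≟ᵍ_)) Fin._≟_)

-- The cost of a choice gadget

+-interchange₃ : ∀ a b c a′ b′ c′ → (a + a′) + (b + b′) + (c + c′) ≡ (a + b + c) + (a′ + b′ + c′)
+-interchange₃ a b c a′ b′ c′ =
  trans (cong (_+ (c + c′)) (+-interchange a a′ b b′)) (+-interchange (a + b) (a′ + b′) c c′)

+-+-∑-interchange : ∀ {n} a a′ b b′ (f f′ : Fin n → ℕ) →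
                (a + a′) + (b + b′) + ∑[ k < n ] (f k + f′ k) ≡ (a + b + sum f) + (a′ + b′ + sum f′)
+-+-∑-interchange a a′ b b′ f f′ =
  trans (cong (_ +_) (∑-distrib-+ f f′)) (+-interchange₃ a b (sum f) a′ b′ (sum f′))

module _ {L2 R A : ℕ} where

  Weight : Set
  Weight = GV L2 R A → ℕ

  _⊕_ : Weight → Weight → Weight
  (ω ⊕ ω′) y = ω y + ω′ y

  forcedCost : Weight → Forced L2 R → ℕ
  forcedCost ω u = ω (base u) + ω (twin u) + ∑[ a < A ] ω (leaf u a)

  coreCost : Weight → Fin L2 → ℕ
  coreCost ω i = ω (κ i) + ω (λv i) + ∑[ j < R ] ω (mv i j)

  rowCost : Weight → Fin L2 → ℕ
  rowCost ω i = forcedCost ω (fℓ i) + forcedCost ω (fℓ' i) + coreCost ω i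

  -- Row i gathers the force gadgets at ℓ_i and ℓ'_i with κ_i, λ_i and M_i, so that the budget
  -- reads 2L · (2A + R) + R · A.
  gadgetCost : Weight → ℕ
  gadgetCost ω = ∑[ i < L2 ] rowCost ω i + ∑[ j < R ] forcedCost ω (fr j)

  forcedCost-⊕ : ∀ ω ω′ u → forcedCost (ω ⊕ ω′) u ≡ forcedCost ω u + forcedCost ω′ u
  forcedCost-⊕ ω ω′ u =
    +-+-∑-interchange (ω (base u)) (ω′ (base u)) (ω (twin u)) (ω′ (twin u)) (ω ∘ leaf u) (ω′ ∘ leaf u)

  coreCost-⊕ : ∀ ω ω′ i → coreCost (ω ⊕ ω′) i ≡ coreCost ω i + coreCost ω′ i
  coreCost-⊕ ω ω′ i =
    +-+-∑-interchange (ω (κ i)) (ω′ (κ i)) (ω (λv i)) (ω′ (λv i)) (ω ∘ mv i) (ω′ ∘ mv i)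

  rowCost-⊕ : ∀ ω ω′ i → rowCost (ω ⊕ ω′) i ≡ rowCost ω i + rowCost ω′ i
  rowCost-⊕ ω ω′ i
    rewrite forcedCost-⊕ ω ω′ (fℓ i) | forcedCost-⊕ ω ω′ (fℓ' i) | coreCost-⊕ ω ω′ i =
    +-interchange₃ (forcedCost ω (fℓ i)) (forcedCost ω (fℓ' i)) (coreCost ω i)
                   (forcedCost ω′ (fℓ i)) (forcedCost ω′ (fℓ' i)) (coreCost ω′ i)

  gadgetCost-⊕ : ∀ ω ω′ → gadgetCost (ω ⊕ ω′) ≡ gadgetCost ω + gadgetCost ω′
  gadgetCost-⊕ ω ω′ = begin
    sum (rowCost (ω ⊕ ω′)) + sum (forcedCost (ω ⊕ ω′) ∘ fr)
      ≡⟨ cong₂ _+_ (sum-cong-≗ (rowCost-⊕ ω ω′)) (sum-cong-≗ (forcedCost-⊕ ω ω′ ∘ fr)) ⟩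
    sum (λ i → ρ i + ρ′ i) + sum (λ j → f j + f′ j)
      ≡⟨ cong₂ _+_ (∑-distrib-+ ρ ρ′) (∑-distrib-+ f f′) ⟩
    (sum ρ + sum ρ′) + (sum f + sum f′)
      ≡⟨ +-interchange (sum ρ) (sum ρ′) (sum f) (sum f′) ⟩
    gadgetCost ω + gadgetCost ω′ ∎
    where
    open ≡-Reasoning
    ρ ρ′ : Fin L2 → ℕ
    ρ  = rowCost ω
    ρ′ = rowCost ω′
    f f′ : Fin R → ℕ
    f  = forcedCost ω ∘ fr
    f′ = forcedCost ω′ ∘ fr

  rowCost-≤-gadgetCost : ∀ ω i → rowCost ω i ≤ gadgetCost ω
  rowCost-≤-gadgetCost ω i = ≤-trans (≤-∑ (rowCost ω) i) (m≤m+n _ _)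

  forcedCost-≤-gadgetCost : ∀ ω u → forcedCost ω u ≤ gadgetCost ω
  forcedCost-≤-gadgetCost ω (fℓ i)  =
    ≤-trans (x≤x+y+z (forcedCost ω (fℓ i)) (forcedCost ω (fℓ' i)) (coreCost ω i)) (rowCost-≤-gadgetCost ω i)
  forcedCost-≤-gadgetCost ω (fℓ' i) =
    ≤-trans (y≤x+y+z (forcedCost ω (fℓ i)) (forcedCost ω (fℓ' i)) (coreCost ω i)) (rowCost-≤-gadgetCost ω i)
  forcedCost-≤-gadgetCost ω (fr j)  = ≤-trans (≤-∑ (forcedCost ω ∘ fr) j) (m≤n+m _ _)

  coreCost-≤-gadgetCost : ∀ ω i → coreCost ω i ≤ gadgetCost ω
  coreCost-≤-gadgetCost ω i =
    ≤-trans (z≤x+y+z (forcedCost ω (fℓ i)) (forcedCost ω (fℓ' i)) (coreCost ω i)) (rowCost-≤-gadgetCost ω i)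

  weight-≤-gadgetCost : ∀ ω y → ω y ≤ gadgetCost ω
  weight-≤-gadgetCost ω (base u)   = ≤-trans (x≤x+y+z _ (ω (twin u)) (∑[ a < A ] ω (leaf u a)))
                                             (forcedCost-≤-gadgetCost ω u)
  weight-≤-gadgetCost ω (twin u)   = ≤-trans (y≤x+y+z (ω (base u)) _ (∑[ a < A ] ω (leaf u a)))
                                             (forcedCost-≤-gadgetCost ω u)
  weight-≤-gadgetCost ω (leaf u a) = ≤-trans (≤-trans (≤-∑ (ω ∘ leaf u) a)
                                                      (z≤x+y+z (ω (base u)) (ω (twin u)) _))
                                             (forcedCost-≤-gadgetCost ω u)
  weight-≤-gadgetCost ω (κ i)      = ≤-trans (x≤x+y+z _ (ω (λv i)) (∑[ j < R ] ω (mv i j)))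
                                             (coreCost-≤-gadgetCost ω i)
  weight-≤-gadgetCost ω (λv i)     = ≤-trans (y≤x+y+z (ω (κ i)) _ (∑[ j < R ] ω (mv i j)))
                                             (coreCost-≤-gadgetCost ω i)
  weight-≤-gadgetCost ω (mv i j)   = ≤-trans (≤-trans (≤-∑ (ω ∘ mv i) j)
                                                      (z≤x+y+z (ω (κ i)) (ω (λv i)) _))
                                             (coreCost-≤-gadgetCost ω i)

-- Counting a large minimal feedback vertex set

row-slack : ∀ {A R w z} → 5 ≤ A → w ≤ 2 + A → z ≤ 2 + R → w + z < 2 * A + R
row-slack {A} {R} {w} {z} 5≤A w≤ z≤ = begin-strict
  w + z               ≤⟨ +-mono-≤ w≤ z≤ ⟩
  2 + A + (2 + R)     ≡⟨ regroup₁ A R ⟩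
  4 + (A + R)         <⟨ ≤-refl ⟩
  5 + (A + R)         ≤⟨ +-monoˡ-≤ (A + R) 5≤A ⟩
  A + (A + R)         ≡⟨ regroup₂ A R ⟩
  2 * A + R           ∎
  where
  open ≤-Reasoning
  regroup₁ : ∀ A R → 2 + A + (2 + R) ≡ 4 + (A + R)
  regroup₁ = solve-∀
  regroup₂ : ∀ A R → A + (A + R) ≡ 2 * A + R
  regroup₂ = solve-∀

gadgetBudget-≡ : ∀ L A R → 2 * L * (2 * A + R) + R * A ≡ 4 * A * L + A * R + 2 * L * R
gadgetBudget-≡ = solve-∀

kOf-≡ : ∀ B Q m → 3 * (Q * B) + m * 1 ≡ B * (3 * Q) + m
kOf-≡ = solve-∀

module ChoiceGadgets (t m : ℕ) (φ : Fin m → Clause (nOf t)) (blk : Blocks t) (σ : Assignments t) where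
  open Construction t m φ blk σ
  open Multiplicity (_≟ᵛ_ {lg t} {L2} {R} {A} {m})
  open import Data.List.Membership.DecPropositional (_≟ᵛ_ {lg t} {L2} {R} {A} {m}) using (_∈?_)

  Adj-sym : ∀ {a b} → Adj a b → Adj b a
  Adj-sym = swap

  Adj-irrefl : ∀ {a} → ¬ Adj a a
  Adj-irrefl (inj₁ (inG _ _ ()))
  Adj-irrefl (inj₂ (inG _ _ ()))

  open MinimalFVS _≟ᵛ_ Adj Adj-sym Adj-irrefl

  leaf-neighbours : ∀ {x p q u a} → Adj x (gad p q (leaf u a)) →
                    x ≡ gad p q (base u) ⊎ x ≡ gad p q (twin u)
  leaf-neighbours (inj₁ (inG _ _ (e-bl _ _))) = inj₁ refl
  leaf-neighbours (inj₁ (inG _ _ (e-tl _ _))) = inj₂ refl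
  leaf-neighbours (inj₂ (inG _ _ ()))

  κ-neighbours : ∀ {x p q i} → Adj x (gad p q (κ i)) →
                 x ≡ gad p q (λv i) ⊎ ∃ λ j → x ≡ gad p q (mv i j)
  κ-neighbours (inj₁ (inG _ _ (e-mκ _ j))) = inj₂ (j , refl)
  κ-neighbours (inj₂ (inG _ _ (e-κλ _)))   = inj₁ refl

  λ-neighbours : ∀ {x p q i} → Adj x (gad p q (λv i)) →
                 x ≡ gad p q (κ i) ⊎ ∃ λ j → x ≡ gad p q (mv i j)
  λ-neighbours (inj₁ (inG _ _ (e-κλ _)))   = inj₁ refl
  λ-neighbours (inj₁ (inG _ _ (e-mλ _ j))) = inj₂ (j , refl)
  λ-neighbours (inj₂ (inG _ _ ()))

  ℓmℓ′m-cycle : ∀ p q i {j j′} → j ≢ j′ →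
                IsCycle Adj (gad p q (base (fℓ i)) ∷ gad p q (mv i j) ∷
                             gad p q (base (fℓ' i)) ∷ gad p q (mv i j′) ∷ [])
  ℓmℓ′m-cycle p q i {j} {j′} j≢j′ =
    s≤s (s≤s (s≤s z≤n)) ,
    ((λ ()) ∷ (λ ()) ∷ (λ ()) ∷ []) ∷ ((λ ()) ∷ m≢m′ ∷ []) ∷ ((λ ()) ∷ []) ∷ [] ∷ [] ,
    inj₂ (inG p q (e-mℓ i j)) ∷ inj₁ (inG p q (e-mℓ' i j)) ∷ inj₂ (inG p q (e-mℓ' i j′)) ∷ [-] ,
    inj₁ (inG p q (e-mℓ i j′))
    where
    m≢m′ : gad p q (mv i j) ≢ gad p q (mv i j′)
    m≢m′ refl = j≢j′ refl

  inGadget-gad : ∀ p q y → inGadget p q (gad p q y) ≡ true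
  inGadget-gad p q y = cong₂ _∧_ (⌊≟⌋-refl Fin._≟_ p) (⌊≟⌋-refl Fin._≟_ q)

  count-≤-gadgetCost : ∀ p q S → countL (inGadget p q) S ≤ gadgetCost (multiplicity S ∘ gad p q)
  count-≤-gadgetCost p q []      = z≤n
  count-≤-gadgetCost p q (x ∷ S) = begin
    ind (inGadget p q x) + countL (inGadget p q) S
      ≤⟨ +-mono-≤ (counted x) (count-≤-gadgetCost p q S) ⟩
    gadgetCost (pointAt x) + gadgetCost (multiplicity S ∘ gad p q)
      ≡⟨ gadgetCost-⊕ (pointAt x) (multiplicity S ∘ gad p q) ⟨
    gadgetCost (multiplicity (x ∷ S) ∘ gad p q) ∎
    where
    open ≤-Reasoning
    pointAt : V → GV L2 R A → ℕ
    pointAt x y = ind ⌊ x ≟ᵛ gad p q y ⌋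
    counted : ∀ x → ind (inGadget p q x) ≤ gadgetCost (pointAt x)
    counted (cl c) = z≤n
    counted (gad p′ q′ y) with p Fin.≟ p′ | q Fin.≟ q′
    ... | yes refl | yes refl = begin
      1                                ≡⟨ cong ind (⌊≟⌋-refl _≟ᵛ_ (gad p q y)) ⟨
      pointAt (gad p q y) y            ≤⟨ weight-≤-gadgetCost (pointAt (gad p q y)) y ⟩
      gadgetCost (pointAt (gad p q y)) ∎
    ... | yes refl | no _ = z≤n
    ... | no _     | _    = z≤n

  gadgetCounts : List V → ℕ
  gadgetCounts S = ∑[ p < 3 ] ∑[ q < lg t ] countL (inGadget p q) S

  clauseCount : List V → ℕ
  clauseCount S = ∑[ c < m ] multiplicity S (cl c)

  length-≤-counts : ∀ S → length S ≤ gadgetCounts S + clauseCount S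
  length-≤-counts []      = z≤n
  length-≤-counts (x ∷ S) = begin
    1 + length S
      ≤⟨ +-mono-≤ (counted x) (length-≤-counts S) ⟩
    (gadgetHits x + clauseHits x) + (gadgetCounts S + clauseCount S)
      ≡⟨ +-interchange (gadgetHits x) (clauseHits x) (gadgetCounts S) (clauseCount S) ⟩
    (gadgetHits x + gadgetCounts S) + (clauseHits x + clauseCount S)
      ≡⟨ cong₂ _+_ gadgetCounts-∷ (∑-distrib-+ (λ c → ind ⌊ x ≟ᵛ cl c ⌋) (multiplicity S ∘ cl)) ⟨
    gadgetCounts (x ∷ S) + clauseCount (x ∷ S) ∎
    where
    open ≤-Reasoning
    gadgetHits : V → ℕ
    gadgetHits x = ∑[ p < 3 ] ∑[ q < lg t ] ind (inGadget p q x)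
    clauseHits : V → ℕ
    clauseHits x = ∑[ c < m ] ind ⌊ x ≟ᵛ cl c ⌋
    gadgetCounts-∷ : gadgetCounts (x ∷ S) ≡ gadgetHits x + gadgetCounts S
    gadgetCounts-∷ =
      trans (sum-cong-≗ (λ p → ∑-distrib-+ (λ q → ind (inGadget p q x)) (λ q → countL (inGadget p q) S)))
            (∑-distrib-+ (λ p → ∑[ q < lg t ] ind (inGadget p q x)) (λ p → ∑[ q < lg t ] countL (inGadget p q) S))
    counted : ∀ x → 1 ≤ gadgetHits x + clauseHits x
    counted (gad p q y) = ≤-trans (≤-trans (≤-trans (≤-reflexive (cong ind (sym (inGadget-gad p q y))))
                                                    (≤-∑ (λ q′ → ind (inGadget p q′ (gad p q y))) q))
                                           (≤-∑ (λ p′ → ∑[ q′ < lg t ] ind (inGadget p′ q′ (gad p q y))) p))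
                                  (m≤m+n _ _)
    counted (cl c) = ≤-trans (≤-trans (≤-reflexive (cong ind (sym (⌊≟⌋-refl _≟ᵛ_ (cl c)))))
                                      (≤-∑ (λ c′ → ind ⌊ cl c ≟ᵛ cl c′ ⌋) c))
                             (m≤n+m _ _)

  module LargeMinimalFVS (S : List V) (S-unique : Unique S) (S-minimal : MinimalFVS Adj S)
                      (5≤A : 5 ≤ A) (k≤|S| : kOf t m ≤ length S) where

    S-¬AtMostOneOutsideNeighbour : ∀ {w z} → w ∈ S → ¬ AtMostOneOutsideNeighbour S w z
    S-¬AtMostOneOutsideNeighbour = minimalFVS⇒¬AtMostOneOutsideNeighbour S-minimal

    2<A : 2 < A
    2<A = ≤-trans (s≤s (s≤s (s≤s z≤n))) 5≤A

    ¬ℓmℓ′m-outside : ∀ p q i {j j′} → j ≢ j′ →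
                     gad p q (base (fℓ i)) ∉ S → gad p q (base (fℓ' i)) ∉ S →
                     gad p q (mv i j) ∉ S → gad p q (mv i j′) ∉ S → ⊥
    ¬ℓmℓ′m-outside p q i j≢j′ ℓ∉ ℓ′∉ m∉ m′∉ =
      proj₁ S-minimal _ (ℓmℓ′m-cycle p q i j≢j′) (ℓ∉ ∷ m∉ ∷ ℓ′∉ ∷ m′∉ ∷ [])

    module Gadget (p : Fin 3) (q : Fin (lg t)) where

      g : GV L2 R A → V
      g = gad p q

      ω : Weight
      ω = multiplicity S ∘ g

      Hit : Forced L2 R → Set
      Hit u = g (base u) ∈ S ⊎ g (twin u) ∈ S

      ω≤1 : ∀ y → ω y ≤ 1
      ω≤1 y = multiplicity-≤1 S-unique (g y)

      ω∉ : ∀ {y} → g y ∉ S → ω y ≡ 0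
      ω∉ = multiplicity-∉

      ¬∉⇒∈ : ∀ y → ¬ g y ∉ S → g y ∈ S
      ¬∉⇒∈ y = decidable-stable (g y ∈? S)

      leaf∉ : ∀ {u} → Hit u → ∀ a → g (leaf u a) ∉ S
      leaf∉ {u} (inj₁ base∈) a leaf∈ = S-¬AtMostOneOutsideNeighbour leaf∈ outside
        where
        outside : AtMostOneOutsideNeighbour S (g (leaf u a)) (g (twin u))
        outside x x~leaf x∉ with leaf-neighbours x~leaf
        ... | inj₁ refl = ⊥-elim (x∉ base∈)
        ... | inj₂ refl = refl
      leaf∉ {u} (inj₂ twin∈) a leaf∈ = S-¬AtMostOneOutsideNeighbour leaf∈ outside
        where
        outside : AtMostOneOutsideNeighbour S (g (leaf u a)) (g (base u))
        outside x x~leaf x∉ with leaf-neighbours x~leaf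
        ... | inj₁ refl = refl
        ... | inj₂ refl = ⊥-elim (x∉ twin∈)

      forcedCost-≤-2 : ∀ {u} → Hit u → forcedCost ω u ≤ 2
      forcedCost-≤-2 {u} hit = begin
        ω (base u) + ω (twin u) + ∑[ a < A ] ω (leaf u a)
          ≤⟨ +-mono-≤ (+-mono-≤ (ω≤1 _) (ω≤1 _)) (∑-≤-* λ a → ≤-reflexive (ω∉ (leaf∉ hit a))) ⟩
        2 + A * 0 ≡⟨ cong (2 +_) (*-zeroʳ A) ⟩
        2         ∎
        where open ≤-Reasoning

      forcedCost-≤-A : ∀ u → forcedCost ω u ≤ A
      forcedCost-≤-A u with g (base u) ∈? S | g (twin u) ∈? S
      ... | yes base∈ | _         = ≤-trans (forcedCost-≤-2 (inj₁ base∈)) (<⇒≤ 2<A)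
      ... | no _      | yes twin∈ = ≤-trans (forcedCost-≤-2 (inj₂ twin∈)) (<⇒≤ 2<A)
      ... | no base∉  | no twin∉ rewrite ω∉ base∉ | ω∉ twin∉ =
        ≤-trans (∑-≤-* (ω≤1 ∘ leaf u)) (≤-reflexive (*-identityʳ A))

      coreCost-≤-2+R : ∀ i → coreCost ω i ≤ 2 + R
      coreCost-≤-2+R i = begin
        ω (κ i) + ω (λv i) + ∑[ j < R ] ω (mv i j)
          ≤⟨ +-mono-≤ (+-mono-≤ (ω≤1 _) (ω≤1 _)) (∑-≤-* (ω≤1 ∘ mv i)) ⟩
        2 + R * 1 ≡⟨ cong (2 +_) (*-identityʳ R) ⟩
        2 + R     ∎
        where open ≤-Reasoning

      -- Two vertices of M_i outside S would close a 4-cycle through ℓ_i and ℓ'_i; minimality then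
      -- keeps κ_i and λ_i out of S if M_i ⊆ S, and keeps one of them out otherwise.
      coreCost-≤-R : ∀ i → g (base (fℓ i)) ∉ S → g (base (fℓ' i)) ∉ S → coreCost ω i ≤ R
      coreCost-≤-R i ℓ∉ ℓ′∉ with Fin.any? (λ j → ¬? (g (mv i j) ∈? S))
      ... | no noneOutside = begin
        ω (κ i) + ω (λv i) + ∑[ j < R ] ω (mv i j)
          ≡⟨ cong₂ (λ a b → a + b + ∑[ j < R ] ω (mv i j))
                   (ω∉ (coreVertex∉ κ-neighbours)) (ω∉ (coreVertex∉ λ-neighbours)) ⟩
        ∑[ j < R ] ω (mv i j) ≤⟨ ∑-≤-* (ω≤1 ∘ mv i) ⟩
        R * 1                 ≡⟨ *-identityʳ R ⟩
        R                     ∎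
        where
        open ≤-Reasoning
        M⊆S : ∀ j → g (mv i j) ∈ S
        M⊆S j = ¬∉⇒∈ (mv i j) λ m∉ → noneOutside (j , m∉)
        coreVertex∉ : ∀ {v v′} → (∀ {x} → Adj x (g v) → x ≡ g v′ ⊎ ∃ λ j → x ≡ g (mv i j)) →
                      g v ∉ S
        coreVertex∉ {v} {v′} neighbours v∈ = S-¬AtMostOneOutsideNeighbour v∈ outside
          where
          outside : AtMostOneOutsideNeighbour S (g v) (g v′)
          outside x x~v x∉ with neighbours x~v
          ... | inj₁ refl       = refl
          ... | inj₂ (j , refl) = ⊥-elim (x∉ (M⊆S j))
      ... | yes (j₀ , m₀∉) = begin
        ω (κ i) + ω (λv i) + ∑[ j < R ] ω (mv i j) ≤⟨ +-monoˡ-≤ _ κλ≤1 ⟩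
        1 + ∑[ j < R ] ω (mv i j)                  ≤⟨ ∑-<-* (ω≤1 ∘ mv i) j₀ m₀<1 ⟩
        R * 1                                      ≡⟨ *-identityʳ R ⟩
        R                                          ∎
        where
        open ≤-Reasoning
        m₀<1 : ω (mv i j₀) < 1
        m₀<1 = ≤-reflexive (cong suc (ω∉ m₀∉))
        others∈ : ∀ j → j ≢ j₀ → g (mv i j) ∈ S
        others∈ j j≢j₀ = ¬∉⇒∈ (mv i j) λ m∉ → ¬ℓmℓ′m-outside p q i j≢j₀ ℓ∉ ℓ′∉ m∉ m₀∉
        outside : g (λv i) ∈ S → AtMostOneOutsideNeighbour S (g (κ i)) (g (mv i j₀))
        outside λ∈ x x~κ x∉ with κ-neighbours x~κ
        ... | inj₁ refl = ⊥-elim (x∉ λ∈)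
        ... | inj₂ (j , refl) with j Fin.≟ j₀
        ...   | yes refl  = refl
        ...   | no j≢j₀   = ⊥-elim (x∉ (others∈ j j≢j₀))
        κλ≤1 : ω (κ i) + ω (λv i) ≤ 1
        κλ≤1 with g (κ i) ∈? S
        ... | no κ∉ rewrite ω∉ κ∉ = ω≤1 _
        ... | yes κ∈ rewrite ω∉ (λ λ∈ → S-¬AtMostOneOutsideNeighbour κ∈ (outside λ∈)) =
          ≤-trans (≤-reflexive (+-identityʳ _)) (ω≤1 _)

      rowCost-< : ∀ i → Hit (fℓ i) ⊎ Hit (fℓ' i) → rowCost ω i < 2 * A + R
      rowCost-< i (inj₁ hit) =
        row-slack 5≤A (+-mono-≤ (forcedCost-≤-2 hit) (forcedCost-≤-A (fℓ' i))) (coreCost-≤-2+R i)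
      rowCost-< i (inj₂ hit) =
        row-slack 5≤A (≤-trans (+-mono-≤ (forcedCost-≤-A (fℓ i)) (forcedCost-≤-2 hit))
                               (≤-reflexive (+-comm A 2)))
                  (coreCost-≤-2+R i)

      rowCost-≤ : ∀ i → rowCost ω i ≤ 2 * A + R
      rowCost-≤ i with g (base (fℓ i)) ∈? S | g (base (fℓ' i)) ∈? S
      ... | yes ℓ∈ | _      = <⇒≤ (rowCost-< i (inj₁ (inj₁ ℓ∈)))
      ... | no _   | yes ℓ′∈ = <⇒≤ (rowCost-< i (inj₂ (inj₁ ℓ′∈)))
      ... | no ℓ∉  | no ℓ′∉ = begin
        rowCost ω i ≤⟨ +-mono-≤ (+-mono-≤ (forcedCost-≤-A (fℓ i)) (forcedCost-≤-A (fℓ' i)))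
                                (coreCost-≤-R i ℓ∉ ℓ′∉) ⟩
        A + A + R   ≡⟨ cong (_+ R) (cong (A +_) (sym (+-identityʳ A))) ⟩
        2 * A + R   ∎
        where open ≤-Reasoning

      gadgetCost-≤ : gadgetCost ω ≤ gadgetBudget t m
      gadgetCost-≤ = ≤-trans (+-mono-≤ (∑-≤-* rowCost-≤) (∑-≤-* (forcedCost-≤-A ∘ fr)))
                             (≤-reflexive (gadgetBudget-≡ (Lof t) A R))

      gadgetCost-< : ∀ u → Hit u → gadgetCost ω < gadgetBudget t m
      gadgetCost-< (fℓ i) hit = <-≤-trans
        (+-mono-<-≤ (∑-<-* rowCost-≤ i (rowCost-< i (inj₁ hit))) (∑-≤-* (forcedCost-≤-A ∘ fr)))
        (≤-reflexive (gadgetBudget-≡ (Lof t) A R))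
      gadgetCost-< (fℓ' i) hit = <-≤-trans
        (+-mono-<-≤ (∑-<-* rowCost-≤ i (rowCost-< i (inj₂ hit))) (∑-≤-* (forcedCost-≤-A ∘ fr)))
        (≤-reflexive (gadgetBudget-≡ (Lof t) A R))
      gadgetCost-< (fr j) hit = <-≤-trans
        (+-mono-≤-< (∑-≤-* rowCost-≤) (∑-<-* (forcedCost-≤-A ∘ fr) j (≤-<-trans (forcedCost-≤-2 hit) 2<A)))
        (≤-reflexive (gadgetBudget-≡ (Lof t) A R))

    count-≤-budget : ∀ p q → countL (inGadget p q) S ≤ gadgetBudget t m
    count-≤-budget p q = ≤-trans (count-≤-gadgetCost p q S) (Gadget.gadgetCost-≤ p q)

    count-<-budget : ∀ p q u → Gadget.Hit p q u → countL (inGadget p q) S < gadgetBudget t m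
    count-<-budget p q u hit = ≤-<-trans (count-≤-gadgetCost p q S) (Gadget.gadgetCost-< p q u hit)

    count-≮-budget : ∀ p q → ¬ countL (inGadget p q) S < gadgetBudget t m
    count-≮-budget p₀ q₀ count<B = <-irrefl refl (<-≤-trans |S|<k k≤|S|)
      where
      open ≤-Reasoning
      B = gadgetBudget t m
      |S|<k : length S < kOf t m
      |S|<k = begin-strict
        length S                        ≤⟨ length-≤-counts S ⟩
        gadgetCounts S + clauseCount S  <⟨ +-mono-<-≤ (∑-<-* (λ p → ∑-≤-* (count-≤-budget p)) p₀
                                                             (∑-<-* (count-≤-budget p₀) q₀ count<B))
                                                      (∑-≤-* (λ c → multiplicity-≤1 S-unique (cl c))) ⟩
        3 * (lg t * B) + m * 1          ≡⟨ kOf-≡ B (lg t) m ⟩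
        kOf t m                         ∎

    conclusion : Conclusion S
    conclusion =
      forced∉ , M-outside-unique , λ p q → ≤-antisym (count-≤-budget p q) (≮⇒≥ (count-≮-budget p q))
      where
      forced∉ : ∀ p q u → gad p q (base u) ∉ S × gad p q (twin u) ∉ S
      forced∉ p q u = (λ base∈ → count-≮-budget p q (count-<-budget p q u (inj₁ base∈))) ,
                      (λ twin∈ → count-≮-budget p q (count-<-budget p q u (inj₂ twin∈)))
      M-outside-unique : ∀ p q i j j′ → gad p q (mv i j) ∉ S → gad p q (mv i j′) ∉ S → j ≡ j′
      M-outside-unique p q i j j′ m∉ m′∉ with j Fin.≟ j′
      ... | yes j≡j′ = j≡j′
      ... | no j≢j′  = ⊥-elim (¬ℓmℓ′m-outside p q i j≢j′ (proj₁ (forced∉ p q (fℓ i)))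
                                                     (proj₁ (forced∉ p q (fℓ' i))) m∉ m′∉)

4≤n⇒5≤A : ∀ t m → 4 ≤ nOf t → 5 ≤ Aof t m
4≤n⇒5≤A t m 4≤n =
  ≤-trans (≤-trans (s≤s (s≤s (s≤s (s≤s (s≤s z≤n))))) (*-mono-≤ 4≤n 4≤n)) (m≤m+n _ m)

lemma4 : ∃ λ (N : ℕ) → ∀ (t : ℕ) → N ≤ nOf t →
    ∀ (m : ℕ) (φ : Fin m → Clause (nOf t)) → AtMostOnePerPart φ →
    ∀ (blk : Blocks t) → BlocksOK t blk →
    ∀ (σ : Assignments t) → Onto t blk σ →
    ∀ (S : List (Construction.V t m φ blk σ)) → Unique S →
    MinimalFVS (Construction.Adj t m φ blk σ) S →
    kOf t m ≤ length S →
    Construction.Conclusion t m φ blk σ S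
-- Largeness of n is only used through A ≥ 5.
lemma4 = 4 , λ t 4≤n m φ _ blk _ σ _ S S-unique S-minimal k≤|S| →
  ChoiceGadgets.LargeMinimalFVS.conclusion t m φ blk σ S S-unique S-minimal (4≤n⇒5≤A t m 4≤n) k≤|S|
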